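{- Let $G$ be a finite simple graph with at least one edge and rational weights $w:E(G)\to[0,\infty)\cap\mathbb{Q}$, and let $\ell$ be the least common multiple of the denominators (in lowest terms) of the weights. Let $H=H(G,w)$ be the simple graph obtained from $G$ as follows: for each edge $e=uv$, if $\ell w(e)=0$ delete $e$; if $\ell w(e)=1$ keep $e$; if $k=\ell w(e)\ge2$, keep the edge $uv$ and add $k-1$ new vertices $x_1,\dots,x_{k-1}$, each adjacent exactly to $u$ and $v$. Then $tw(H)\le\max\{tw(G),\max\{\ell w(e):e\in E(G)\}\}$.
   Context: A tree decomposition of a graph $G$ is a tree $T$ whose nodes are subsets $X_1,\dots,X_n$ of $V(G)$ such that $\bigcup_i X_i=V(G)$, for each vertex $v$ the nodes containing $v$ form a connected subtree (every node on the path between two nodes containing $v$ contains $v$), and every edge of $G$ has both endpoints in some $X_i$. Its width is $\max_i|X_i|-1$; $tw(G)$ is the minimum width over all tree decompositions. -}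

module Defs where

open import Level using (Level; 0ℓ) renaming (suc to lsuc)
open import Data.Nat using (ℕ; zero; suc; _≤_; _⊔_; _<ᵇ_; _∸_)
open import Data.Nat.LCM using (lcm)
open import Data.Fin using (Fin; toℕ)
open import Data.Bool using (Bool; true; false; _∧_; if_then_else_)
open import Data.List using (List; []; _∷_; [_]; length; head; last; concatMap; allFin; foldr; map; lookup; _∷ʳ_)
open import Data.List.Relation.Unary.All using (All)
open import Data.List.Relation.Unary.Unique.Propositional using (Unique)
open import Data.List.Membership.Propositional using (_∈_)
open import Data.Maybe using (just)
open import Data.Product using (Σ; ∃; ∃-syntax; _×_; _,_; proj₁; proj₂)
open import Data.Sum using (_⊎_; inj₁; inj₂)
open import Data.Empty using (⊥)
open import Data.Unit using (⊤)
open import Data.Integer using (+_; ∣_∣)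
open import Data.Rational using (ℚ; ↥_; _*_; _/_)
open import Relation.Binary.PropositionalEquality using (_≡_)
open import Relation.Nullary using (¬_)

module _ {V : Set} (Adj : V → V → Set) where

  Chain : List V → Set
  Chain []           = ⊤
  Chain (x ∷ [])     = ⊤
  Chain (x ∷ y ∷ xs) = Adj x y × Chain (y ∷ xs)

  IsPath : V → V → List V → Set
  IsPath a b p = Chain p × Unique p × head p ≡ just a × last p ≡ just b

  IsCycle : List V → Set
  IsCycle []      = ⊥
  IsCycle (x ∷ c) = Chain ((x ∷ c) ∷ʳ x) × Unique (x ∷ c) × 3 ≤ length (x ∷ c)

  Connected : Set
  Connected = ∀ a b → ∃[ p ] IsPath a b p

  Acyclic : Set
  Acyclic = ∀ c → ¬ IsCycle c

record IsTree {m : ℕ} (TAdj : Fin m → Fin m → Set) : Set where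
  field
    sym       : ∀ {i j} → TAdj i j → TAdj j i
    irrefl    : ∀ {i} → ¬ TAdj i i
    connected : Connected TAdj
    acyclic   : Acyclic TAdj

-- Tree decomposition of a graph (V, Adj). Bags are finite subsets of V,
-- represented as duplicate-free lists (so length = cardinality).
record TreeDecomposition {V : Set} (Adj : V → V → Set) : Set₁ where
  field
    m       : ℕ
    TAdj    : Fin m → Fin m → Set
    isTree  : IsTree TAdj
    bag     : Fin m → List V
    bagUniq : ∀ i → Unique (bag i)
    cover   : ∀ v → ∃[ i ] (v ∈ bag i)
    edgeCov : ∀ u v → Adj u v → ∃[ i ] (u ∈ bag i × v ∈ bag i)
    subtree : ∀ v i j p → IsPath TAdj i j p → v ∈ bag i → v ∈ bag j →
              All (λ t → v ∈ bag t) p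

-- width ≤ k  ⇔  max_i |X_i| - 1 ≤ k  ⇔  every bag has at most k+1 vertices
WidthLe : {V : Set} {Adj : V → V → Set} → TreeDecomposition Adj → ℕ → Set
WidthLe T k = ∀ i → length (TreeDecomposition.bag T i) ≤ suc k

TwLe : {V : Set} → (V → V → Set) → ℕ → Set₁
TwLe Adj k = Σ (TreeDecomposition Adj) (λ T → WidthLe T k)

IsTreewidth : {V : Set} → (V → V → Set) → ℕ → Set₁
IsTreewidth Adj t = TwLe Adj t × (∀ s → TwLe Adj s → t ≤ s)

record FinGraph : Set where
  field
    n      : ℕ
    adj    : Fin n → Fin n → Bool
    sym    : ∀ u v → adj u v ≡ adj v u
    irrefl : ∀ v → adj v v ≡ false

module _ (G : FinGraph) where
  open FinGraph G

  Adj : Fin n → Fin n → Set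
  Adj u v = adj u v ≡ true

  -- E(G): each edge {u,v} listed once, as (u , v) with u < v
  edges : List (Fin n × Fin n)
  edges = concatMap (λ u → concatMap (λ v →
            if (toℕ u <ᵇ toℕ v) ∧ adj u v then [ (u , v) ] else [])
              (allFin n)) (allFin n)

  Edge : Set
  Edge = Fin (length edges)

  ends : Edge → Fin n × Fin n
  ends e = lookup edges e

  module _ (w : Edge → ℚ) where

    -- ℓ = lcm of the denominators (ℚ is always in lowest terms)
    ℓ : ℕ
    ℓ = foldr lcm 1 (map (λ e → ℚ.denominatorℕ (w e)) (allFin (length edges)))

    -- ℓ·w(e) as a natural number (it is a nonnegative integer by choice of ℓ)
    lw : Edge → ℕ
    lw e = ∣ ↥ ((+ ℓ / 1) * w e) ∣

    maxLw : ℕ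
    maxLw = foldr _⊔_ 0 (map lw (allFin (length edges)))

    HVertex : Set
    HVertex = Fin n ⊎ Σ Edge (λ e → Fin (lw e ∸ 1))

    IsEnd : Edge → Fin n → Set
    IsEnd e u = proj₁ (ends e) ≡ u ⊎ proj₂ (ends e) ≡ u

    HAdj : HVertex → HVertex → Set
    HAdj (inj₁ u) (inj₁ v) =
      Σ Edge (λ e → (ends e ≡ (u , v) ⊎ ends e ≡ (v , u)) × 1 ≤ lw e)
    HAdj (inj₁ u) (inj₂ (e , _)) = IsEnd e u
    HAdj (inj₂ (e , _)) (inj₁ u) = IsEnd e u
    HAdj (inj₂ _) (inj₂ _) = ⊥

module Submission where

-- Fix a tree decomposition (T, X) of G of width t and
-- put W = max(t, max_e ℓ·w(e)).  The edges e = uv of G are processed one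
-- at a time.  Since uv is an edge, some bag X_a contains u and v; attach a
-- new leaf to the node a and give it the bag {u, v, x_1, ..., x_{k-1}},
-- where x_1, ..., x_{k-1} (k = ℓ·w(e)) are the vertices H adds for e.  These
-- occur in no other bag and u, v already lie in X_a, so the subtree property
-- survives, and the new bag has 2 + (k - 1) ≤ W + 1 elements because k ≤ W
-- and W ≥ t ≥ 1 (a bag holding the two ends of an edge has width ≥ 1).

module Development where

  open import Defs
  open import Data.Bool using (true; if_then_else_)
  open import Data.Bool.Properties using (∧-conicalʳ)
  open import Data.Empty using (⊥; ⊥-elim)
  open import Data.Fin using (Fin; zero; suc; _≟_)
  open import Data.Fin.Properties using (suc-injective)
  open import Data.List
    using (List; []; _∷_; [_]; _++_; _∷ʳ_; map; head; last; length; allFin; foldr)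
  open import Data.List.Properties using (++-assoc; length-++; length-map; length-tabulate; map-++)
  open import Data.List.Relation.Unary.All using (All; []; _∷_)
  import Data.List.Relation.Unary.All as All
  import Data.List.Relation.Unary.All.Properties as AllP
  open import Data.List.Relation.Unary.AllPairs using ([]; _∷_)
  open import Data.List.Relation.Unary.Any using (here; there)
  import Data.List.Relation.Unary.Any as Any
  open import Data.List.Relation.Unary.Unique.Propositional using (Unique)
  import Data.List.Relation.Unary.Unique.Propositional.Properties as UniqueP
  open import Data.List.Membership.Propositional using (_∈_; _∉_)
  open import Data.List.Membership.Propositional.Properties
    using (∈-∃++; ∈-++⁺ʳ; ∈-map⁺; ∈-map⁻; ∈-allFin; ∈-lookup; ∈-concatMap⁻)
  open import Data.Maybe using (just)
  import Data.Nat as ℕ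
  open import Data.Nat using (ℕ; _+_; _≤_; _⊔_; _∸_; s≤s; s≤s⁻¹; z≤n)
  open import Data.Nat.Properties using (≤-trans; m≤m⊔n; m≤n⊔m; +-comm)
  open import Data.Product using (Σ; ∃-syntax; _×_; _,_; proj₁; proj₂)
  open import Data.Rational using (ℚ)
  open import Data.Sum using (_⊎_; inj₁; inj₂)
  open import Data.Sum.Properties using (inj₁-injective)
  open import Data.Unit using (tt)
  open import Relation.Binary.Definitions using (Symmetric)
  open import Relation.Binary.PropositionalEquality
    using (_≡_; _≢_; refl; sym; trans; cong; subst)
  open import Relation.Nullary using (¬_; yes; no)

  module _ {A : Set} where

    last-∷ʳ : ∀ (xs : List A) x → last (xs ∷ʳ x) ≡ just x
    last-∷ʳ []           x = refl
    last-∷ʳ (y ∷ [])     x = refl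
    last-∷ʳ (y ∷ z ∷ xs) x = last-∷ʳ (z ∷ xs) x

    last-∈ : ∀ (x : A) xs → ∃[ y ] (last (x ∷ xs) ≡ just y × y ∈ x ∷ xs)
    last-∈ x []        = x , refl , here refl
    last-∈ x (x′ ∷ xs) with last-∈ x′ xs
    ... | y , eq , y∈ = y , eq , there y∈

    unique-∷ʳ : ∀ {x : A} xs → Unique (x ∷ xs) → Unique (xs ∷ʳ x)
    unique-∷ʳ []       _                         = [] ∷ []
    unique-∷ʳ (y ∷ ys) ((x≢y ∷ x∉ys) ∷ (y∉ys ∷ u)) =
      AllP.++⁺ y∉ys ((λ y≡x → x≢y (sym y≡x)) ∷ []) ∷ unique-∷ʳ ys (x∉ys ∷ u)

    unique-++ˡ : ∀ (xs : List A) {ys} → Unique (xs ++ ys) → Unique xs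
    unique-++ˡ []       _        = []
    unique-++ˡ (x ∷ xs) (x∉ ∷ u) = AllP.++⁻ˡ xs x∉ ∷ unique-++ˡ xs u

    unique-++ʳ : ∀ (xs : List A) {ys} → Unique (xs ++ ys) → Unique ys
    unique-++ʳ []       u       = u
    unique-++ʳ (x ∷ xs) (_ ∷ u) = unique-++ʳ xs u

    unique-disjoint : ∀ (xs : List A) {ys x} → Unique (xs ++ ys) → x ∈ xs → x ∉ ys
    unique-disjoint (_ ∷ xs) (x∉ ∷ _) (here refl) x∈ys = All.lookup x∉ (∈-++⁺ʳ xs x∈ys) refl
    unique-disjoint (_ ∷ xs) (_ ∷ u) (there x∈) x∈ys = unique-disjoint xs u x∈ x∈ys

  module _ {V : Set} {R : V → V → Set} where

    chain-++ˡ : ∀ xs {ys} → Chain R (xs ++ ys) → Chain R xs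
    chain-++ˡ []           _       = tt
    chain-++ˡ (x ∷ [])     _       = tt
    chain-++ˡ (x ∷ y ∷ xs) (r , c) = r , chain-++ˡ (y ∷ xs) c

    chain-++ʳ : ∀ xs {ys} → Chain R (xs ++ ys) → Chain R ys
    chain-++ʳ []                     c       = c
    chain-++ʳ (x ∷ [])     {[]}     _       = tt
    chain-++ʳ (x ∷ [])     {y ∷ ys} (_ , c) = c
    chain-++ʳ (x ∷ y ∷ xs)          (_ , c) = chain-++ʳ (y ∷ xs) c

    chain-junction : ∀ xs {y ys z} → Chain R (xs ++ y ∷ ys) → last xs ≡ just z → R z y
    chain-junction (x ∷ [])     (r , _) refl = r
    chain-junction (x ∷ x′ ∷ xs) (_ , c) eq  = chain-junction (x′ ∷ xs) c eq

    chain-++⁺ : ∀ xs {y ys z} → Chain R xs → last xs ≡ just z → R z y →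
                Chain R (y ∷ ys) → Chain R (xs ++ y ∷ ys)
    chain-++⁺ (x ∷ [])      _        refl r c = r , c
    chain-++⁺ (x ∷ x′ ∷ xs) (r′ , c′) eq  r c = r′ , chain-++⁺ (x′ ∷ xs) c′ eq r c

    module _ {U : Set} {S : U → U → Set} (f : V → U) where

      chain-map⁺ : (∀ {x y} → R x y → S (f x) (f y)) → ∀ q → Chain R q → Chain S (map f q)
      chain-map⁺ pres []          _       = tt
      chain-map⁺ pres (x ∷ [])    _       = tt
      chain-map⁺ pres (x ∷ y ∷ q) (r , c) = pres r , chain-map⁺ pres (y ∷ q) c

      chain-map⁻ : (∀ {x y} → S (f x) (f y) → R x y) → ∀ q → Chain S (map f q) → Chain R q
      chain-map⁻ reflects []          _       = tt
      chain-map⁻ reflects (x ∷ [])    _       = tt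
      chain-map⁻ reflects (x ∷ y ∷ q) (s , c) = reflects s , chain-map⁻ reflects (y ∷ q) c

    rotate : ∀ {x y} c → IsCycle R (x ∷ y ∷ c) → IsCycle R (y ∷ (c ∷ʳ x))
    rotate {x} {y} c ((rxy , chain) , u , len) =
      chain-++⁺ (y ∷ c ∷ʳ x) chain (last-∷ʳ (y ∷ c) x) rxy tt ,
      unique-∷ʳ (y ∷ c) u ,
      subst (λ k → 3 ≤ 1 + k) (sym (trans (length-++ c) (+-comm (length c) 1))) len

    rotate-to : ∀ pre {x c y post} → x ∷ c ≡ pre ++ y ∷ post → IsCycle R (x ∷ c) →
                ∃[ c′ ] IsCycle R (y ∷ c′)
    rotate-to []                        refl cy = _ , cy
    rotate-to (p ∷ [])     {post = post} refl cy = _ , rotate post cy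
    rotate-to (p ∷ q ∷ pre) {y = y} {post} refl cy =
      rotate-to (q ∷ pre) (cong (q ∷_) (++-assoc pre (y ∷ post) [ p ]))
                (rotate (pre ++ y ∷ post) cy)

    -- The first vertex of a cycle has two distinct neighbours: the next
    -- vertex and the last one.
    first-has-two-neighbours : Symmetric R → ∀ {y} c → IsCycle R (y ∷ c) →
                               ∃[ y₁ ] ∃[ y₂ ] (y₁ ≢ y₂ × R y y₁ × R y y₂)
    first-has-two-neighbours _ []         (_ , _ , s≤s ())
    first-has-two-neighbours _ (_ ∷ [])   (_ , _ , s≤s (s≤s ()))
    first-has-two-neighbours symR {y} (c₀ ∷ c₁ ∷ c) (chain , (_ ∷ (c₀∉ ∷ _)) , _)
      with last-∈ c₁ c
    ... | z , last≡z , z∈ =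
      c₀ , z , All.lookup c₀∉ z∈ , proj₁ chain ,
      symR (chain-junction (y ∷ c₀ ∷ c₁ ∷ c) chain last≡z)

    on-cycle⇒two-neighbours : Symmetric R → ∀ {y c} → y ∈ c → IsCycle R c →
                              ∃[ y₁ ] ∃[ y₂ ] (y₁ ≢ y₂ × R y y₁ × R y y₂)
    on-cycle⇒two-neighbours symR {c = x ∷ c} y∈ cy with ∈-∃++ y∈
    ... | pre , post , eq with rotate-to pre eq cy
    ...   | c′ , cy′ = first-has-two-neighbours symR c′ cy′

  SubtreeProperty : ∀ {m} → (Fin m → Fin m → Set) → {V : Set} → (Fin m → List V) → Set
  SubtreeProperty {m} TAdj {V} bag =
    ∀ (v : V) (i j : Fin m) p → IsPath TAdj i j p → v ∈ bag i → v ∈ bag j →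
    All (λ k → v ∈ bag k) p

  -- Attaching a new leaf, node zero, to the node a of a tree on Fin m; the
  -- old node i becomes suc i.

  module LeafExtension {m : ℕ} {TAdj : Fin m → Fin m → Set} (tree : IsTree TAdj) (a : Fin m) where

    private
      module T = IsTree tree

    open import Data.List.Membership.DecPropositional (_≟_ {n = 1 + m}) using (_∈?_)

    LeafAdj : Fin (1 + m) → Fin (1 + m) → Set
    LeafAdj zero    zero    = ⊥
    LeafAdj zero    (suc j) = a ≡ j
    LeafAdj (suc i) zero    = a ≡ i
    LeafAdj (suc i) (suc j) = TAdj i j

    leafAdj-sym : Symmetric LeafAdj
    leafAdj-sym {zero}  {suc j} a≡j = a≡j
    leafAdj-sym {suc i} {zero}  a≡i = a≡i
    leafAdj-sym {suc i} {suc j} r   = T.sym r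

    leafAdj-irrefl : ∀ {i} → ¬ LeafAdj i i
    leafAdj-irrefl {zero}  ()
    leafAdj-irrefl {suc i} r = T.irrefl r

    leaf-neighbour : ∀ {j} → LeafAdj zero j → j ≡ suc a
    leaf-neighbour {suc j} refl = refl

    leaf≢lifted : ∀ (q : List (Fin m)) → All (zero ≢_) (map suc q)
    leaf≢lifted []      = []
    leaf≢lifted (_ ∷ q) = (λ ()) ∷ leaf≢lifted q

    leaf∉lifted : ∀ (q : List (Fin m)) → zero ∉ map suc q
    leaf∉lifted q z∈ = All.lookup (leaf≢lifted q) z∈ refl

    unlift : ∀ (l : List (Fin (1 + m))) → zero ∉ l → ∃[ q ] (l ≡ map suc q)
    unlift []          _  = [] , refl
    unlift (zero ∷ l)  z∉ = ⊥-elim (z∉ (here refl))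
    unlift (suc i ∷ l) z∉ with unlift l (λ z∈ → z∉ (there z∈))
    ... | q , refl = i ∷ q , refl

    lifted-unique : ∀ {q : List (Fin m)} → Unique q → Unique (map suc q)
    lifted-unique = UniqueP.map⁺ {f = suc} suc-injective

    lifted-chain : ∀ q → Chain TAdj q → Chain LeafAdj (map suc q)
    lifted-chain = chain-map⁺ suc (λ r → r)

    lifted-last : ∀ (q : List (Fin m)) {j} → last q ≡ just j → last (map suc q) ≡ just (suc j)
    lifted-last (x ∷ [])     refl = refl
    lifted-last (x ∷ y ∷ q) eq   = lifted-last (y ∷ q) eq

    lowered-last : ∀ (q₀ : Fin m) q {j} → last (map suc (q₀ ∷ q)) ≡ just j →
                   ∃[ j′ ] (j ≡ suc j′ × last (q₀ ∷ q) ≡ just j′)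
    lowered-last q₀ []       refl = q₀ , refl , refl
    lowered-last q₀ (q₁ ∷ q) eq   = lowered-last q₁ q eq

    lift-path : ∀ {i j q} → IsPath TAdj i j q → IsPath LeafAdj (suc i) (suc j) (map suc q)
    lift-path {q = q₀ ∷ q} (chain , u , refl , l) =
      lifted-chain (q₀ ∷ q) chain , lifted-unique u , refl , lifted-last (q₀ ∷ q) l

    lower-path : ∀ {i j q} → Chain LeafAdj (map suc q) → Unique (map suc q) →
                 head q ≡ just i → last q ≡ just j → IsPath TAdj i j q
    lower-path {q = q} chain u h l = chain-map⁻ suc (λ r → r) q chain , UniqueP.map⁻ u , h , l

    -- The shapes of paths in the extended tree: the leaf can only be an
    -- endpoint, and the path then continues (or arrives) through a.
    data LeafPath : Fin (1 + m) → Fin (1 + m) → List (Fin (1 + m)) → Set where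
      avoiding  : ∀ {i j q} → IsPath TAdj i j q → LeafPath (suc i) (suc j) (map suc q)
      leaf-only : LeafPath zero zero [ zero ]
      from-leaf : ∀ {j q} → IsPath TAdj a j q → LeafPath zero (suc j) (zero ∷ map suc q)
      to-leaf   : ∀ {i q} → IsPath TAdj i a q → LeafPath (suc i) zero (map suc q ∷ʳ zero)

    leafPath⇒path : ∀ {i j p} → LeafPath i j p → IsPath LeafAdj i j p
    leafPath⇒path (avoiding π) = lift-path π
    leafPath⇒path leaf-only    = tt , [] ∷ [] , refl , refl
    leafPath⇒path (from-leaf {q = q₀ ∷ q} π@(_ , _ , refl , _))
      with lift-path π
    ... | chain , u , _ , l = (refl , chain) , leaf≢lifted (q₀ ∷ q) ∷ u , refl , l
    leafPath⇒path (to-leaf {q = q₀ ∷ q} π@(_ , _ , refl , l))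
      with lift-path π
    ... | chain , u , _ , _ =
      chain-++⁺ (map suc (q₀ ∷ q)) {z = suc a} chain (lifted-last (q₀ ∷ q) l) refl tt ,
      UniqueP.++⁺ u ([] ∷ []) (λ { (z∈ , here refl) → leaf∉lifted (q₀ ∷ q) z∈ }) ,
      refl , last-∷ʳ (map suc (q₀ ∷ q)) zero

    avoiding-path : ∀ (q : List (Fin m)) {i j} → IsPath LeafAdj i j (map suc q) →
                    LeafPath i j (map suc q)
    avoiding-path []       (_ , _ , () , _)
    avoiding-path (q₀ ∷ q) (chain , u , refl , l) with lowered-last q₀ q l
    ... | j′ , refl , l′ = avoiding (lower-path chain u refl l′)

    -- A path through the leaf: the leaf's only neighbour is a, so it cannot
    -- have old nodes on both sides, as a would then occur twice.
    through-leaf : ∀ (qa qb : List (Fin m)) {i j} →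
                   IsPath LeafAdj i j (map suc qa ++ zero ∷ map suc qb) →
                   LeafPath i j (map suc qa ++ zero ∷ map suc qb)
    through-leaf [] [] (_ , _ , refl , refl) = leaf-only
    through-leaf [] (b ∷ qb) ((refl , chain) , (_ ∷ u) , refl , l)
      with lowered-last a qb l
    ... | j′ , refl , l′ = from-leaf (lower-path chain u refl l′)
    through-leaf (x ∷ qa) [] (chain , u , refl , l)
      with trans (sym (last-∷ʳ (map suc (x ∷ qa)) zero)) l | last-∈ x qa
    ... | refl | z , last≡z , _
      with chain-junction (map suc (x ∷ qa)) chain (lifted-last (x ∷ qa) last≡z)
    ... | refl = to-leaf (lower-path (chain-++ˡ (map suc (x ∷ qa)) chain)
                                     (unique-++ˡ (map suc (x ∷ qa)) u) refl last≡z)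
    through-leaf (x ∷ qa) (b ∷ qb) (chain , u , _ , _) with last-∈ x qa
    ... | z , last≡z , z∈
      with chain-junction (map suc (x ∷ qa)) chain (lifted-last (x ∷ qa) last≡z)
         | chain-++ʳ (map suc (x ∷ qa)) chain
    ... | refl | refl , _ = ⊥-elim (
      unique-disjoint (map suc (x ∷ qa)) u (∈-map⁺ suc z∈) (there (here refl)))

    path⇒leafPath : ∀ {i j p} → IsPath LeafAdj i j p → LeafPath i j p
    path⇒leafPath {p = p} π@(_ , u , _) with zero ∈? p
    ... | no leaf∉ with unlift p leaf∉
    ...   | q , refl = avoiding-path q π
    path⇒leafPath {p = p} π@(_ , u , _) | yes leaf∈ with ∈-∃++ leaf∈
    ... | pre , post , refl
      with unlift pre (λ z∈ → unique-disjoint pre u z∈ (here refl))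
         | unlift post (UniqueP.Unique[x∷xs]⇒x∉xs (unique-++ʳ pre u))
    ... | qa , refl | qb , refl = through-leaf qa qb π

    lower-cycle : ∀ (q : List (Fin m)) → IsCycle LeafAdj (map suc q) → IsCycle TAdj q
    lower-cycle (q₀ ∷ q) (chain , u , len) =
      chain-map⁻ suc (λ r → r) (q₀ ∷ q ∷ʳ q₀)
        (subst (Chain LeafAdj) (sym (map-++ suc (q₀ ∷ q) [ q₀ ])) chain) ,
      UniqueP.map⁻ u ,
      subst (3 ≤_) (length-map suc (q₀ ∷ q)) len

    leaf-connected : Connected LeafAdj
    leaf-connected zero    zero    = _ , leafPath⇒path leaf-only
    leaf-connected zero    (suc j) = _ , leafPath⇒path (from-leaf (proj₂ (T.connected a j)))
    leaf-connected (suc i) zero    = _ , leafPath⇒path (to-leaf (proj₂ (T.connected i a)))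
    leaf-connected (suc i) (suc j) = _ , leafPath⇒path (avoiding (proj₂ (T.connected i j)))

    -- A cycle through the leaf would give it two distinct neighbours; a cycle
    -- avoiding it is a cycle of the old tree.
    leaf-acyclic : Acyclic LeafAdj
    leaf-acyclic c cy with zero ∈? c
    ... | yes leaf∈ with on-cycle⇒two-neighbours (λ {i} {j} → leafAdj-sym {i} {j}) leaf∈ cy
    ...   | _ , _ , y₁≢y₂ , r₁ , r₂ = y₁≢y₂ (trans (leaf-neighbour r₁) (sym (leaf-neighbour r₂)))
    leaf-acyclic c cy | no leaf∉ with unlift c leaf∉
    ... | q , refl = T.acyclic q (lower-cycle q cy)

    leaf-tree : IsTree LeafAdj
    leaf-tree = record
      { sym = λ {i} {j} → leafAdj-sym {i} {j} ; irrefl = λ {i} → leafAdj-irrefl {i}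
      ; connected = leaf-connected ; acyclic = leaf-acyclic }

    module WithBags {V : Set} (bag : Fin m → List V) (subtree : SubtreeProperty TAdj bag)
             (B : List V) (shared⊆bag-a : ∀ {v j} → v ∈ B → v ∈ bag j → v ∈ bag a) where

      leafBag : Fin (1 + m) → List V
      leafBag zero    = B
      leafBag (suc i) = bag i

      leaf-subtree : SubtreeProperty LeafAdj leafBag
      leaf-subtree v i j p π = along (path⇒leafPath π)
        where
          in-old : ∀ {i j q} → IsPath TAdj i j q → v ∈ bag i → v ∈ bag j →
                   All (λ k → v ∈ leafBag k) (map suc q)
          in-old {i} {j} {q} π′ vi vj = AllP.map⁺ (subtree v i j q π′ vi vj)

          along : ∀ {i j p} → LeafPath i j p → v ∈ leafBag i → v ∈ leafBag j →
                  All (λ k → v ∈ leafBag k) p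
          along (avoiding π′) vi vj = in-old π′ vi vj
          along leaf-only     vi _  = vi ∷ []
          along (from-leaf π′) vi vj = vi ∷ in-old π′ (shared⊆bag-a vi vj) vj
          along (to-leaf π′)   vi vj = AllP.++⁺ (in-old π′ vi (shared⊆bag-a vj vi)) (vj ∷ [])

  decomposition-mono : ∀ {V : Set} {R S : V → V → Set} {k} →
                       (∀ {x y} → R x y → S x y) → TwLe S k → TwLe R k
  decomposition-mono R⊆S (D , width) =
    record { TreeDecomposition D hiding (edgeCov)
           ; edgeCov = λ x y r → TreeDecomposition.edgeCov D x y (R⊆S r) } ,
    width

  -- H(G, w) is a spanning subgraph of it for extra e = ℓ·w(e) - 1.
  module CommonNeighbours {N E : Set} (Adj : N → N → Set) (ends : E → N × N) (extra : E → ℕ) where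

    CNVertex : Set
    CNVertex = N ⊎ Σ E (λ e → Fin (extra e))

    IsEndOf : E → N → Set
    IsEndOf e u = proj₁ (ends e) ≡ u ⊎ proj₂ (ends e) ≡ u

    CNAdj : CNVertex → CNVertex → Set
    CNAdj (inj₁ u)       (inj₁ v)       = Adj u v
    CNAdj (inj₁ u)       (inj₂ (e , _)) = IsEndOf e u
    CNAdj (inj₂ (e , _)) (inj₁ u)       = IsEndOf e u
    CNAdj (inj₂ _)       (inj₂ _)       = ⊥

    new : (e : E) → Fin (extra e) → CNVertex
    new e j = inj₂ (e , j)

    newVertices : E → List CNVertex
    newVertices e = map (new e) (allFin (extra e))

    edgeBag : E → List CNVertex
    edgeBag e = inj₁ (proj₁ (ends e)) ∷ inj₁ (proj₂ (ends e)) ∷ newVertices e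

    new∈edgeBag : ∀ e j → new e j ∈ edgeBag e
    new∈edgeBag e j = there (there (∈-map⁺ (new e) (∈-allFin j)))

    new∈edgeBag⇒same : ∀ {e e′ j} → new e′ j ∈ edgeBag e → e′ ≡ e
    new∈edgeBag⇒same (there (there x∈)) with ∈-map⁻ _ x∈
    ... | _ , _ , refl = refl

    edgeBag-length : ∀ e → length (edgeBag e) ≡ 2 + extra e
    edgeBag-length e =
      cong (2 +_) (trans (length-map (new e) (allFin (extra e)))
                         (length-tabulate {n = extra e} (λ j → j)))

    edgeBag-unique : ∀ {e} → proj₁ (ends e) ≢ proj₂ (ends e) → Unique (edgeBag e)
    edgeBag-unique {e} u≢v =
      ((λ eq → u≢v (inj₁-injective eq)) ∷ old∉new _) ∷
      (old∉new _ ∷ UniqueP.map⁺ (λ { refl → refl }) (UniqueP.allFin⁺ (extra e)))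
      where
        old∉new : ∀ u → All (inj₁ u ≢_) (newVertices e)
        old∉new u = AllP.map⁺ (All.universal (λ _ ()) _)

    -- The construction, from a decomposition of (N, Adj) of width t ≤ W,
    -- provided each edge bag, of size 2 + extra e, has at most W + 1 elements.
    module Build (ends-adjacent : ∀ e → Adj (proj₁ (ends e)) (proj₂ (ends e)))
                 (ends-distinct : ∀ e → proj₁ (ends e) ≢ proj₂ (ends e))
                 {t W : ℕ} (decomp : TwLe Adj t) (t≤W : t ≤ W) (fits : ∀ e → 1 + extra e ≤ W) where

      -- A tree decomposition of width at most W of the part of the graph
      -- made of N and the new vertices of the edges in done; the new
      -- vertices of the other edges occur in no bag yet.
      record Stage (done : List E) : Set₁ where
        field
          m         : ℕ
          TAdj      : Fin m → Fin m → Set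
          isTree    : IsTree TAdj
          bag       : Fin m → List CNVertex
          bagUniq   : ∀ i → Unique (bag i)
          subtree   : SubtreeProperty TAdj bag
          width     : ∀ i → length (bag i) ≤ 1 + W
          cover-old : ∀ u → ∃[ i ] (inj₁ u ∈ bag i)
          cover-new : ∀ {e} → e ∈ done → ∀ j → ∃[ i ] (new e j ∈ bag i)
          edges-old : ∀ u v → Adj u v → ∃[ i ] (inj₁ u ∈ bag i × inj₁ v ∈ bag i)
          edges-new : ∀ {e} → e ∈ done → ∀ u j → IsEndOf e u →
                      ∃[ i ] (inj₁ u ∈ bag i × new e j ∈ bag i)
          fresh     : ∀ {e j i} → new e j ∈ bag i → e ∈ done

      initial : Stage []
      initial = record
        { m = D.m ; TAdj = D.TAdj ; isTree = D.isTree
        ; bag = bag₀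
        ; bagUniq = λ i → UniqueP.map⁺ inj₁-injective (D.bagUniq i)
        ; subtree = subtree₀
        ; width = λ i → subst (_≤ 1 + W) (sym (length-map inj₁ (D.bag i)))
                              (≤-trans (proj₂ decomp i) (s≤s t≤W))
        ; cover-old = λ u → let (i , u∈) = D.cover u in i , ∈-map⁺ inj₁ u∈
        ; cover-new = λ ()
        ; edges-old = λ u v uv → let (i , u∈ , v∈) = D.edgeCov u v uv in
                                 i , ∈-map⁺ inj₁ u∈ , ∈-map⁺ inj₁ v∈
        ; edges-new = λ ()
        ; fresh = fresh₀
        }
        where
          module D = TreeDecomposition (proj₁ decomp)

          bag₀ : Fin D.m → List CNVertex
          bag₀ i = map inj₁ (D.bag i)

          subtree₀ : SubtreeProperty D.TAdj bag₀
          subtree₀ x i j p π x∈i x∈j with ∈-map⁻ inj₁ x∈i | ∈-map⁻ inj₁ x∈j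
          ... | u , u∈i , refl | _ , u∈j , refl =
            All.map (∈-map⁺ inj₁) (D.subtree u i j p π u∈i u∈j)

          fresh₀ : ∀ {e j i} → new e j ∈ bag₀ i → e ∈ []
          fresh₀ x∈ with ∈-map⁻ inj₁ x∈
          ... | _ , _ , ()

      -- Processing one more edge e = uv: attach a leaf with bag edgeBag e to
      -- a node a whose bag holds u and v.  The new vertices of e are fresh,
      -- so the new bag meets the old ones only in u and v, which lie in the
      -- bag of a.
      extend : ∀ {done e} → e ∉ done → Stage done → Stage (e ∷ done)
      extend {done} {e} e∉done S = record
        { m = 1 + S.m ; TAdj = LeafAdj ; isTree = leaf-tree
        ; bag = leafBag ; subtree = leaf-subtree
        ; bagUniq = λ { zero → edgeBag-unique (ends-distinct e) ; (suc i) → S.bagUniq i }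
        ; width = λ { zero → subst (_≤ 1 + W) (sym (edgeBag-length e)) (s≤s (fits e))
                    ; (suc i) → S.width i }
        ; cover-old = λ u → old (S.cover-old u)
        ; cover-new = cover-new
        ; edges-old = λ u v uv → old (S.edges-old u v uv)
        ; edges-new = edges-new
        ; fresh = λ {e′} {j} {i} → fresh {e′} {j} {i}
        }
        where
          module S = Stage S

          a-holds-ends : ∃[ a ] (inj₁ (proj₁ (ends e)) ∈ S.bag a × inj₁ (proj₂ (ends e)) ∈ S.bag a)
          a-holds-ends = S.edges-old _ _ (ends-adjacent e)

          a : Fin S.m
          a = proj₁ a-holds-ends

          shared⊆bag-a : ∀ {x j} → x ∈ edgeBag e → x ∈ S.bag j → x ∈ S.bag a
          shared⊆bag-a (here refl)         _   = proj₁ (proj₂ a-holds-ends)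
          shared⊆bag-a (there (here refl)) _   = proj₂ (proj₂ a-holds-ends)
          shared⊆bag-a (there (there x∈))  x∈j with ∈-map⁻ _ x∈
          ... | _ , _ , refl = ⊥-elim (e∉done (S.fresh x∈j))

          open LeafExtension S.isTree a
          open WithBags S.bag S.subtree (edgeBag e) shared⊆bag-a

          old : ∀ {P : Fin (1 + S.m) → Set} → ∃[ i ] P (suc i) → ∃[ i ] P i
          old (i , p) = suc i , p

          cover-new : ∀ {e′} → e′ ∈ e ∷ done → ∀ j → ∃[ i ] (new e′ j ∈ leafBag i)
          cover-new (here refl) j = zero , new∈edgeBag e j
          cover-new (there e′∈) j = old (S.cover-new e′∈ j)

          edges-new : ∀ {e′} → e′ ∈ e ∷ done → ∀ u j → IsEndOf e′ u →
                      ∃[ i ] (inj₁ u ∈ leafBag i × new e′ j ∈ leafBag i)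
          edges-new (here refl) _ j (inj₁ refl) = zero , here refl , new∈edgeBag e j
          edges-new (here refl) _ j (inj₂ refl) = zero , there (here refl) , new∈edgeBag e j
          edges-new (there e′∈) u j end = old (S.edges-new e′∈ u j end)

          fresh : ∀ {e′ j i} → new e′ j ∈ leafBag i → e′ ∈ e ∷ done
          fresh {i = zero}  x∈ = here (new∈edgeBag⇒same x∈)
          fresh {i = suc i} x∈ = there (S.fresh x∈)

      stage : ∀ done → Unique done → Stage done
      stage []         _           = initial
      stage (e ∷ done) (e∉ ∷ uniq) =
        extend (UniqueP.Unique[x∷xs]⇒x∉xs (e∉ ∷ uniq)) (stage done uniq)

      decomposition : ∀ es → Unique es → (∀ e → e ∈ es) → TwLe CNAdj W
      decomposition es uniq all∈ = record
        { m = S.m ; TAdj = S.TAdj ; isTree = S.isTree ; bag = S.bag ; bagUniq = S.bagUniq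
        ; cover = cover ; edgeCov = edgeCov ; subtree = S.subtree } , S.width
        where
          module S = Stage (stage es uniq)

          cover : ∀ x → ∃[ i ] (x ∈ S.bag i)
          cover (inj₁ u)       = S.cover-old u
          cover (inj₂ (e , j)) = S.cover-new (all∈ e) j

          edgeCov : ∀ x y → CNAdj x y → ∃[ i ] (x ∈ S.bag i × y ∈ S.bag i)
          edgeCov (inj₁ u)       (inj₁ v)       uv  = S.edges-old u v uv
          edgeCov (inj₁ u)       (inj₂ (e , j)) end = S.edges-new (all∈ e) u j end
          edgeCov (inj₂ (e , j)) (inj₁ u)       end with S.edges-new (all∈ e) u j end
          ... | i , u∈ , x∈ = i , x∈ , u∈

  ≤-maximum : ∀ {x} xs → x ∈ xs → x ≤ foldr _⊔_ 0 xs
  ≤-maximum (y ∷ xs) (here refl) = m≤m⊔n y _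
  ≤-maximum (y ∷ xs) (there x∈)  = ≤-trans (≤-maximum xs x∈) (m≤n⊔m y _)

  two-members : ∀ {A : Set} {x y : A} (l : List A) → x ∈ l → y ∈ l → x ≢ y → 2 ≤ length l
  two-members (_ ∷ [])    (here refl) (here refl) x≢y = ⊥-elim (x≢y refl)
  two-members (_ ∷ [])    (here _)    (there ())  _
  two-members (_ ∷ [])    (there ())  _           _
  two-members (_ ∷ _ ∷ _) _           _           _   = s≤s (s≤s z≤n)

  pred-fits : ∀ {k W} → k ≤ W → 1 ≤ W → 1 + (k ∸ 1) ≤ W
  pred-fits {ℕ.zero}  _   1≤W = 1≤W
  pred-fits {ℕ.suc k} k<W _   = k<W

  ∈-if : ∀ {A : Set} b {x y : A} → y ∈ (if b then [ x ] else []) → b ≡ true × y ≡ x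
  ∈-if true (here y≡x) = refl , y≡x

  module _ (G : FinGraph) where
    open FinGraph G using (n; irrefl)

    listed⇒adjacent : ∀ {u v} → (u , v) ∈ edges G → Adj G u v
    listed⇒adjacent uv∈ with Any.satisfied (∈-concatMap⁻ _ {xs = allFin n} uv∈)
    ... | _ , uv∈′ with Any.satisfied (∈-concatMap⁻ _ {xs = allFin n} uv∈′)
    ... | _ , uv∈″ with ∈-if _ uv∈″
    ... | selected , refl = ∧-conicalʳ _ _ selected

    edge-adjacent : ∀ e → Adj G (proj₁ (ends G e)) (proj₂ (ends G e))
    edge-adjacent e = listed⇒adjacent (∈-lookup {xs = edges G} e)

    adjacent⇒distinct : ∀ {u v} → Adj G u v → u ≢ v
    adjacent⇒distinct {u} uu refl with trans (sym uu) (irrefl u)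
    ... | ()

    edge⇒1≤width : ∀ {t u v} → TwLe (Adj G) t → Adj G u v → 1 ≤ t
    edge⇒1≤width {u = u} {v} (D , width) uv with TreeDecomposition.edgeCov D u v uv
    ... | i , u∈ , v∈ =
      s≤s⁻¹ (≤-trans (two-members _ u∈ v∈ (adjacent⇒distinct uv)) (width i))

  module ForH (G : FinGraph) (w : Edge G → ℚ) {t : ℕ} (decompG : TwLe (Adj G) t) where

    open CommonNeighbours (Adj G) (ends G) (λ e → lw G w e ∸ 1)

    W : ℕ
    W = t ⊔ maxLw G w

    fits : ∀ e → 1 + (lw G w e ∸ 1) ≤ W
    fits e = pred-fits weight≤W (≤-trans (edge⇒1≤width G decompG (edge-adjacent G e)) (m≤m⊔n t _))
      where
        weight≤W : lw G w e ≤ W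
        weight≤W = ≤-trans (≤-maximum _ (∈-map⁺ (lw G w) (∈-allFin e))) (m≤n⊔m t _)

    -- H keeps an edge uv of G only if uv ∈ E(G), and joins the new vertices
    -- of e exactly to the ends of e.
    HAdj⊆CNAdj : ∀ {x y} → HAdj G w x y → CNAdj x y
    HAdj⊆CNAdj {inj₁ u} {inj₁ v} (e , inj₁ refl , _) = edge-adjacent G e
    HAdj⊆CNAdj {inj₁ u} {inj₁ v} (e , inj₂ refl , _) =
      trans (FinGraph.sym G u v) (edge-adjacent G e)
    HAdj⊆CNAdj {inj₁ _} {inj₂ _} end = end
    HAdj⊆CNAdj {inj₂ _} {inj₁ _} end = end

    H-decomposition : TwLe (HAdj G w) W
    H-decomposition =
      decomposition-mono HAdj⊆CNAdj
        (Build.decomposition (edge-adjacent G) (λ e → adjacent⇒distinct G (edge-adjacent G e))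
           decompG (m≤m⊔n t _) fits (allFin _) (UniqueP.allFin⁺ _) ∈-allFin)

open import Defs
open import Data.Nat using (ℕ; _<_; _⊔_)
open import Data.List using (length)
open import Data.Product using (_,_)
open import Data.Rational using (ℚ; 0ℚ; _≤_)

lemma3p1 : (G : FinGraph) → 0 < length (edges G) →
    (w : Edge G → ℚ) → (∀ e → 0ℚ ≤ w e) →
    (t : ℕ) → IsTreewidth (Adj G) t →
    TwLe (HAdj G w) (t ⊔ maxLw G w)
lemma3p1 G _ w _ _ (decompG , _) = Development.ForH.H-decomposition G w decompG
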